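{- Let $\Delta$ be of type $C_p$ ($p\ge2$). For each $k=0,1,\dots,p-1$, the number of antichains of $\Delta^+$ consisting of exactly $k$ short roots and no long root equals $\binom{p}{k}\binom{p-1}{k}$, and this also equals the number of antichains of $\Delta^+$ consisting of exactly $p-1-k$ short roots and exactly one long root.
   Context: $\Delta^+$ is a positive system of the root system of type $C_p$ with simple roots $\Pi$. On $\Delta^+$, $\mu\preccurlyeq\gamma$ iff $\gamma-\mu$ is a nonnegative integer combination of simple roots; an antichain is a set of pairwise incomparable positive roots. -}

module Defs where

open import Data.Nat using (ℕ; zero; suc; _+_; _∸_; _≤_; _≤?_; _<ᵇ_; _≟_)
open import Data.Nat.Properties using (m+[n∸m]≡n; m≤m+n)
open import Data.Bool using (Bool; true; false; if_then_else_)
open import Data.Fin using (Fin; toℕ; _<?_) renaming (_<_ to _<ꟳ_)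
open import Data.Fin.Properties using (all?)
open import Data.List using (List; []; _∷_; _++_; map; concatMap; length; filter)
open import Data.List.Base using (allFin)
open import Data.List.Relation.Unary.AllPairs using (AllPairs; allPairs?)
open import Data.Product using (Σ; _×_; _,_)
open import Relation.Nullary using (¬_; Dec; yes; no)
open import Relation.Nullary.Decidable using (_×-dec_; ¬?)
open import Relation.Binary.PropositionalEquality using (_≡_; sym; subst)

-- Positive roots of C_p in the ε-basis, indices 0..p-1:
--   minus i j : e_i - e_j  (i < j)   short
--   plus  i j : e_i + e_j  (i < j)   short
--   long  i   : 2 e_i               long
data Root (p : ℕ) : Set where
  minus : (i j : Fin p) → i <ꟳ j → Root p
  plus  : (i j : Fin p) → i <ꟳ j → Root p
  long  : (i : Fin p) → Root p

-- Simple roots Π = {α_0,…,α_{p-1}}, α_k = e_k - e_{k+1} (k < p-1), α_{p-1} = 2 e_{p-1}.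
-- coeff γ k = coefficient of α_k in the expansion of γ in the basis Π:
--   e_i - e_j = α_i + … + α_{j-1}
--   e_i + e_j = α_i + … + α_{j-1} + 2(α_j + … + α_{p-2}) + α_{p-1}
--   2 e_i     = 2(α_i + … + α_{p-2}) + α_{p-1}
coeff : {p : ℕ} → Root p → Fin p → ℕ
coeff (minus i j _) k =
  if toℕ k <ᵇ toℕ i then 0 else if toℕ k <ᵇ toℕ j then 1 else 0
coeff {p} (plus i j _) k =
  if toℕ k <ᵇ toℕ i then 0 else if toℕ k <ᵇ toℕ j then 1
  else if suc (toℕ k) <ᵇ p then 2 else 1
coeff {p} (long i) k =
  if toℕ k <ᵇ toℕ i then 0 else if suc (toℕ k) <ᵇ p then 2 else 1

_≼_ : {p : ℕ} → Root p → Root p → Set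
_≼_ {p} μ γ = Σ (Fin p → ℕ) λ c → ∀ k → coeff γ k ≡ coeff μ k + c k

_≼?_ : {p : ℕ} → (μ γ : Root p) → Dec (μ ≼ γ)
μ ≼? γ with all? (λ k → coeff μ k ≤? coeff γ k)
... | yes h = yes ((λ k → coeff γ k ∸ coeff μ k) , λ k → sym (m+[n∸m]≡n (h k)))
... | no ¬h = no λ { (c , e) → ¬h (λ k → subst (coeff μ k ≤_) (sym (e k)) (m≤m+n _ _)) }

Incomparable : {p : ℕ} → Root p → Root p → Set
Incomparable μ γ = ¬ (μ ≼ γ) × ¬ (γ ≼ μ)

incomparable? : {p : ℕ} → (μ γ : Root p) → Dec (Incomparable μ γ)
incomparable? μ γ = ¬? (μ ≼? γ) ×-dec ¬? (γ ≼? μ)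

IsAntichain : {p : ℕ} → List (Root p) → Set
IsAntichain = AllPairs Incomparable

isShort : {p : ℕ} → Root p → Bool
isShort (minus _ _ _) = true
isShort (plus _ _ _) = true
isShort (long _) = false

numShort numLong : {p : ℕ} → List (Root p) → ℕ
numShort [] = 0
numShort (x ∷ xs) = (if isShort x then 1 else 0) + numShort xs
numLong [] = 0
numLong (x ∷ xs) = (if isShort x then 0 else 1) + numLong xs

pairRoots : {p : ℕ} → Fin p → Fin p → List (Root p)
pairRoots i j with i <? j
... | yes i<j = minus i j i<j ∷ plus i j i<j ∷ []
... | no _ = []

positiveRoots : (p : ℕ) → List (Root p)
positiveRoots p =
  concatMap (λ i → concatMap (λ j → pairRoots i j) (allFin p)) (allFin p)
  ++ map long (allFin p)

-- All sublists (= all subsets, since the list has no duplicates)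
sublists : {A : Set} → List A → List (List A)
sublists [] = [] ∷ []
sublists (x ∷ xs) = sublists xs ++ map (x ∷_) (sublists xs)

numAntichains : (p s l : ℕ) → ℕ
numAntichains p s l =
  length (filter (λ S → allPairs? incomparable? S ×-dec (numShort S ≟ s) ×-dec (numLong S ≟ l))
                 (sublists (positiveRoots p)))

{-# OPTIONS --safe #-}
-- Write p = q + 1 and send e_i − e_j, e_i + e_j and 2e_i to the intervals [i, j), [i, 2q+1−j)
-- and [i, 2q+1−i) of the positions 0, 1, …, 2q, a line folded at q. The coefficient of the simple
-- root α_t in a root is the number of the positions t and 2q−t covered by its interval, so μ ≼ γ
-- exactly when the interval of μ lies inside that of γ, and an antichain is a set of pairwise
-- staggered intervals (a < c and b < d). The short roots fill the staircase a < b ≤ 2q−a, and the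
-- short roots incomparable with 2e_m fill the trapezoid a < m, a < b ≤ 2q−m. Removing the top row
-- of a staircase gives a recurrence whose solution on trapezoids is C(a+1,k+1)C(b,k) − C(a,k+1)C(b+1,k);
-- summing over the rows of the staircase, resp. over m, telescopes to C(p,k)C(p−1,k), resp.
-- C(p,k+1)C(p−1,k), and C(n,k) = C(n,n−k) matches the two counts.
module Submission where

open import Defs
open import Data.Nat using (ℕ; _≤_; _<_; _*_; _∸_)
open import Data.Nat.Combinatorics using (_C_)
open import Data.Product using (_×_)
open import Relation.Binary.PropositionalEquality using (_≡_)

open import Data.Bool using (true; false; if_then_else_)
open import Data.Empty using (⊥)
open import Data.Fin as Fin using (Fin; toℕ; fromℕ<)
open import Data.Fin.Properties using (toℕ<n; toℕ-fromℕ<; toℕ-injective)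
open import Data.Integer as ℤ using (ℤ; +_; 0ℤ; 1ℤ)
import Data.Integer.Properties as ℤ
open import Data.Integer.Tactic.RingSolver using (solve-∀)
open import Data.List using (List; []; _∷_; _++_; map; filter; length; concatMap; allFin; applyUpTo; tabulate)
open import Data.List.Membership.Propositional using (_∈_)
open import Data.List.Membership.Propositional.Properties
  using (∈-++⁺ˡ; ∈-++⁺ʳ; ∈-++⁻; ∈-filter⁺; ∈-filter⁻; ∈-map⁺; ∈-map⁻; ∈-concatMap⁺; ∈-allFin)
open import Data.List.Membership.Propositional.Properties.WithK using (unique∧set⇒bag)
open import Data.List.Properties
  using (length-++; length-map; filter-++; filter-none; filter-≐; map-++; map-∘; map-cong; map-tabulate; applyUpTo-∷ʳ)
open import Data.List.Relation.Binary.BagAndSetEquality using (∼bag⇒↭)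
open import Data.List.Relation.Binary.Permutation.Propositional as ↭ using (_↭_; prep; swap)
import Data.List.Relation.Binary.Permutation.Propositional.Properties as ↭
open import Data.List.Relation.Unary.All as All using (All; []; _∷_)
import Data.List.Relation.Unary.All.Properties as All
open import Data.List.Relation.Unary.AllPairs as AllPairs using (AllPairs; []; _∷_; allPairs?)
import Data.List.Relation.Unary.AllPairs.Properties as AllPairs
open import Data.List.Relation.Unary.Any as Any using (here; there)
open import Data.List.Relation.Unary.Unique.Propositional using (Unique)
import Data.List.Relation.Unary.Unique.Propositional.Properties as Unique
open import Data.Nat as ℕ using (zero; suc; _+_; _<ᵇ_; _≟_; _<?_; _≤?_; z≤n; s≤s; s≤s⁻¹)
open import Data.Nat.Combinatorics using (nCk+nC[k+1]≡[n+1]C[k+1]; nC1≡n; nCk≡nC[n∸k])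
open import Data.Nat.ListAction using (sum)
open import Data.Nat.ListAction.Properties using (sum-++; sum-↭)
open import Data.Nat.Properties
open import Algebra.Properties.CommutativeSemigroup +-commutativeSemigroup using (interchange)
open import Data.Product using (_,_; proj₁; proj₂)
open import Data.Sum using (_⊎_; inj₁; inj₂)
open import Function using (_∘_; id; _⇔_; mk⇔; Equivalence)
open import Level using (0ℓ)
open import Relation.Binary using (Rel; Symmetric; tri<; tri≈; tri>) renaming (Decidable to Decidable₂)
open import Relation.Binary.PropositionalEquality
  using (_≢_; refl; sym; trans; cong; cong₂; subst; subst₂; module ≡-Reasoning)
open import Relation.Nullary using (¬_; yes; no; contradiction)
open import Relation.Nullary.Decidable using (_×-dec_; _⊎-dec_)
open import Relation.Unary using (Pred; Decidable; _⊆_)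

open Equivalence using (to; from)

filter-map : {A B : Set} {P : Pred B 0ℓ} (P? : Decidable P) (f : A → B) (xs : List A) →
             filter P? (map f xs) ≡ map f (filter (P? ∘ f) xs)
filter-map P? f [] = refl
filter-map P? f (x ∷ xs) with P? (f x)
... | yes _ = cong (f x ∷_) (filter-map P? f xs)
... | no _ = filter-map P? f xs

length-filter-map : {A B : Set} {P : Pred B 0ℓ} (P? : Decidable P) (f : A → B) (xs : List A) →
                    length (filter P? (map f xs)) ≡ length (filter (P? ∘ f) xs)
length-filter-map P? f xs = trans (cong length (filter-map P? f xs)) (length-map f (filter (P? ∘ f) xs))

sublists-map : {A B : Set} (f : A → B) (xs : List A) → sublists (map f xs) ≡ map (map f) (sublists xs)
sublists-map f [] = refl
sublists-map f (x ∷ xs) = begin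
  sublists (map f xs) ++ map (f x ∷_) (sublists (map f xs))
    ≡⟨ cong (λ L → L ++ map (f x ∷_) L) (sublists-map f xs) ⟩
  map (map f) (sublists xs) ++ map (f x ∷_) (map (map f) (sublists xs))
    ≡⟨ cong (map (map f) (sublists xs) ++_) (trans (sym (map-∘ (sublists xs))) (map-∘ (sublists xs))) ⟩
  map (map f) (sublists xs) ++ map (map f) (map (x ∷_) (sublists xs))
    ≡⟨ map-++ (map f) (sublists xs) _ ⟨
  map (map f) (sublists (x ∷ xs)) ∎
  where open ≡-Reasoning

tabulate-toℕ : {A : Set} (n : ℕ) (f : ℕ → A) → tabulate {n = n} (f ∘ toℕ) ≡ applyUpTo f n
tabulate-toℕ zero f = refl
tabulate-toℕ (suc n) f = cong (f 0 ∷_) (tabulate-toℕ n (f ∘ suc))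

module _ {A B : Set} {f : A → List B} where

  All-concatMap⁺ : {P : Pred B 0ℓ} → (∀ x → All P (f x)) → ∀ xs → All P (concatMap f xs)
  All-concatMap⁺ Pf xs = All.concat⁺ (All.map⁺ (All.universal Pf xs))

  concatMap-unique : (tag : B → A) → (∀ x → All (λ b → tag b ≡ x) (f x)) → (∀ x → Unique (f x)) →
                     ∀ {xs} → Unique xs → Unique (concatMap f xs)
  concatMap-unique tag tagged !f !xs =
    Unique.concat⁺ (All.map⁺ (All.universal !f _)) (AllPairs.map⁺ (AllPairs.map disjoint !xs))
    where
      disjoint : ∀ {x x′} → x ≢ x′ → ∀ {b} → ¬ (b ∈ f x × b ∈ f x′)
      disjoint x≢x′ (b∈fx , b∈fx′) = x≢x′ (trans (sym (All.lookup (tagged _) b∈fx)) (All.lookup (tagged _) b∈fx′))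

module _ {A : Set} where

  countSublists : {P : Pred (List A) 0ℓ} → Decidable P → List A → ℕ
  countSublists P? xs = length (filter P? (sublists xs))

  countSublists-∷ : {P : Pred (List A) 0ℓ} (P? : Decidable P) (x : A) (xs : List A) →
                    countSublists P? (x ∷ xs) ≡ countSublists P? xs + countSublists (P? ∘ (x ∷_)) xs
  countSublists-∷ P? x xs = begin
    length (filter P? (sublists xs ++ map (x ∷_) (sublists xs)))
      ≡⟨ cong length (filter-++ P? (sublists xs) _) ⟩
    length (filter P? (sublists xs) ++ filter P? (map (x ∷_) (sublists xs)))
      ≡⟨ length-++ (filter P? (sublists xs)) ⟩
    countSublists P? xs + length (filter P? (map (x ∷_) (sublists xs)))
      ≡⟨ cong (_+_ (countSublists P? xs)) (length-filter-map P? (x ∷_) (sublists xs)) ⟩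
    countSublists P? xs + countSublists (P? ∘ (x ∷_)) xs ∎
    where open ≡-Reasoning

  countSublists-cong : {P Q : Pred (List A) 0ℓ} (P? : Decidable P) (Q? : Decidable Q) →
                       P ⊆ Q → Q ⊆ P → ∀ xs → countSublists P? xs ≡ countSublists Q? xs
  countSublists-cong P? Q? P⊆Q Q⊆P xs = cong length (filter-≐ P? Q? (P⊆Q , Q⊆P) (sublists xs))

  countSublists-reject : {P : Pred (List A) 0ℓ} (P? : Decidable P) →
                         (∀ S → ¬ P S) → ∀ xs → countSublists P? xs ≡ 0
  countSublists-reject P? ¬P xs = cong length (filter-none P? (All.universal ¬P (sublists xs)))

  countSublists-congAll : {G : Pred A 0ℓ} {P Q : Pred (List A) 0ℓ} (P? : Decidable P) (Q? : Decidable Q) →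
                          (∀ {S} → All G S → P S → Q S) → (∀ {S} → All G S → Q S → P S) →
                          ∀ {xs} → All G xs → countSublists P? xs ≡ countSublists Q? xs
  countSublists-congAll P? Q? P⇒Q Q⇒P {[]} [] with P? [] | Q? []
  ... | yes _ | yes _ = refl
  ... | yes p | no ¬q = contradiction (P⇒Q [] p) ¬q
  ... | no ¬p | yes q = contradiction (Q⇒P [] q) ¬p
  ... | no _  | no _  = refl
  countSublists-congAll P? Q? P⇒Q Q⇒P {x ∷ xs} (gx ∷ gxs) = begin
    countSublists P? (x ∷ xs)                                      ≡⟨ countSublists-∷ P? x xs ⟩
    countSublists P? xs + countSublists (P? ∘ (x ∷_)) xs
      ≡⟨ cong₂ _+_ (countSublists-congAll P? Q? P⇒Q Q⇒P gxs)
                   (countSublists-congAll (P? ∘ (x ∷_)) (Q? ∘ (x ∷_)) (P⇒Q ∘ (gx ∷_)) (Q⇒P ∘ (gx ∷_)) gxs) ⟩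
    countSublists Q? xs + countSublists (Q? ∘ (x ∷_)) xs           ≡⟨ countSublists-∷ Q? x xs ⟨
    countSublists Q? (x ∷ xs)                                      ∎
    where open ≡-Reasoning

  countSublists-filter : {Q : Pred A 0ℓ} {P : Pred (List A) 0ℓ} (Q? : Decidable Q) (P? : Decidable P) →
                         ∀ xs → countSublists (λ S → All.all? Q? S ×-dec P? S) xs ≡ countSublists P? (filter Q? xs)
  countSublists-filter Q? P? [] with P? []
  ... | yes _ = refl
  ... | no _ = refl
  countSublists-filter {Q} {P} Q? P? (x ∷ xs) with Q? x
  ... | yes qx = begin
    countSublists QP? (x ∷ xs)                                   ≡⟨ countSublists-∷ QP? x xs ⟩
    countSublists QP? xs + countSublists (QP? ∘ (x ∷_)) xs
      ≡⟨ cong₂ _+_ (countSublists-filter Q? P? xs)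
                   (countSublists-cong (QP? ∘ (x ∷_)) QPx? (λ { (_ ∷ qS , p) → qS , p }) (λ (qS , p) → qx ∷ qS , p) xs) ⟩
    countSublists P? (filter Q? xs) + countSublists QPx? xs
      ≡⟨ cong (_+_ (countSublists P? (filter Q? xs))) (countSublists-filter Q? (P? ∘ (x ∷_)) xs) ⟩
    countSublists P? (filter Q? xs) + countSublists (P? ∘ (x ∷_)) (filter Q? xs)
      ≡⟨ countSublists-∷ P? x (filter Q? xs) ⟨
    countSublists P? (x ∷ filter Q? xs)                          ∎
    where
      open ≡-Reasoning
      QP? : Decidable (λ S → All Q S × P S)
      QP? S = All.all? Q? S ×-dec P? S
      QPx? : Decidable (λ S → All Q S × P (x ∷ S))
      QPx? S = All.all? Q? S ×-dec P? (x ∷ S)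
  ... | no ¬qx = begin
    countSublists QP? (x ∷ xs)                                   ≡⟨ countSublists-∷ QP? x xs ⟩
    countSublists QP? xs + countSublists (QP? ∘ (x ∷_)) xs
      ≡⟨ cong₂ _+_ (countSublists-filter Q? P? xs)
                   (countSublists-reject (QP? ∘ (x ∷_)) (λ { _ (qx ∷ _ , _) → ¬qx qx }) xs) ⟩
    countSublists P? (filter Q? xs) + 0                          ≡⟨ +-identityʳ _ ⟩
    countSublists P? (filter Q? xs)                              ∎
    where
      open ≡-Reasoning
      QP? : Decidable (λ S → All Q S × P S)
      QP? S = All.all? Q? S ×-dec P? S

  ↭-Invariant : Pred (List A) 0ℓ → Set
  ↭-Invariant P = ∀ {S S′} → S ↭ S′ → P S → P S′

  countSublists-↭ : {P : Pred (List A) 0ℓ} (P? : Decidable P) → ↭-Invariant P →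
                    ∀ {xs ys} → xs ↭ ys → countSublists P? xs ≡ countSublists P? ys
  countSublists-↭ P? inv ↭.refl = refl
  countSublists-↭ P? inv (prep {xs} {ys} x σ) = begin
    countSublists P? (x ∷ xs)                                ≡⟨ countSublists-∷ P? x xs ⟩
    countSublists P? xs + countSublists (P? ∘ (x ∷_)) xs
      ≡⟨ cong₂ _+_ (countSublists-↭ P? inv σ) (countSublists-↭ (P? ∘ (x ∷_)) (inv ∘ prep x) σ) ⟩
    countSublists P? ys + countSublists (P? ∘ (x ∷_)) ys     ≡⟨ countSublists-∷ P? x ys ⟨
    countSublists P? (x ∷ ys)                                ∎
    where open ≡-Reasoning
  countSublists-↭ {P} P? inv (swap {xs} {ys} x y σ) = begin
    countSublists P? (x ∷ y ∷ xs)                            ≡⟨ expand x y xs ⟩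
    (# P? xs + # Py? xs) + (# Px? xs + # Pxy? xs)            ≡⟨ interchange (# P? xs) _ _ _ ⟩
    (# P? xs + # Px? xs) + (# Py? xs + # Pxy? xs)
      ≡⟨ cong₂ _+_ (cong₂ _+_ (countSublists-↭ P? inv σ) (countSublists-↭ Px? (inv ∘ prep x) σ))
                   (cong₂ _+_ (countSublists-↭ Py? (inv ∘ prep y) σ) xy≡yx) ⟩
    (# P? ys + # Px? ys) + (# Py? ys + # Pyx? ys)            ≡⟨ expand y x ys ⟨
    countSublists P? (y ∷ x ∷ ys)                            ∎
    where
      open ≡-Reasoning
      # : {Q : Pred (List A) 0ℓ} → Decidable Q → List A → ℕ
      # = countSublists
      Px? : Decidable (λ S → P (x ∷ S))
      Px? = P? ∘ (x ∷_)
      Py? : Decidable (λ S → P (y ∷ S))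
      Py? = P? ∘ (y ∷_)
      Pxy? : Decidable (λ S → P (x ∷ y ∷ S))
      Pxy? = P? ∘ (λ S → x ∷ y ∷ S)
      Pyx? : Decidable (λ S → P (y ∷ x ∷ S))
      Pyx? = P? ∘ (λ S → y ∷ x ∷ S)
      expand : ∀ u v zs → # P? (u ∷ v ∷ zs) ≡
                          (# P? zs + # (P? ∘ (v ∷_)) zs) + (# (P? ∘ (u ∷_)) zs + # (P? ∘ (λ S → u ∷ v ∷ S)) zs)
      expand u v zs = trans (countSublists-∷ P? u (v ∷ zs))
                            (cong₂ _+_ (countSublists-∷ P? v zs) (countSublists-∷ (P? ∘ (u ∷_)) v zs))
      xy≡yx : # Pxy? xs ≡ # Pyx? ys
      xy≡yx = trans (countSublists-↭ Pxy? (inv ∘ prep x ∘ prep y) σ)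
                    (countSublists-cong Pxy? Pyx? (inv (swap x y ↭.refl)) (inv (swap y x ↭.refl)) ys)
  countSublists-↭ P? inv (↭.trans σ τ) = trans (countSublists-↭ P? inv σ) (countSublists-↭ P? inv τ)

countSublists-map : {A B : Set} {P : Pred (List B) 0ℓ} (P? : Decidable P) (f : A → B) →
                    ∀ xs → countSublists P? (map f xs) ≡ countSublists (P? ∘ map f) xs
countSublists-map P? f xs = trans (cong (length ∘ filter P?) (sublists-map f xs)) (length-filter-map P? (map f) (sublists xs))

module Antichains {A : Set} {_∥_ : Rel A 0ℓ} (_∥?_ : Decidable₂ _∥_) where

  Antichain : ℕ → Pred (List A) 0ℓ
  Antichain k S = AllPairs _∥_ S × length S ≡ k

  antichain? : ∀ k → Decidable (Antichain k)
  antichain? k S = allPairs? _∥?_ S ×-dec (length S ≟ k)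

  #antichains : List A → ℕ → ℕ
  #antichains xs k = countSublists (antichain? k) xs

  #antichains-zero : ∀ xs → #antichains xs 0 ≡ 1
  #antichains-zero [] = refl
  #antichains-zero (x ∷ xs) = begin
    #antichains (x ∷ xs) 0                                          ≡⟨ countSublists-∷ (antichain? 0) x xs ⟩
    #antichains xs 0 + countSublists (antichain? 0 ∘ (x ∷_)) xs
      ≡⟨ cong₂ _+_ (#antichains-zero xs) (countSublists-reject (antichain? 0 ∘ (x ∷_)) (λ _ ()) xs) ⟩
    1                                                               ∎
    where open ≡-Reasoning

  #antichains-∷ : ∀ x xs k →
                  #antichains (x ∷ xs) (suc k) ≡ #antichains xs (suc k) + #antichains (filter (x ∥?_) xs) k
  #antichains-∷ x xs k = begin
    #antichains (x ∷ xs) (suc k)                                      ≡⟨ countSublists-∷ (antichain? (suc k)) x xs ⟩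
    #antichains xs (suc k) + countSublists (antichain? (suc k) ∘ (x ∷_)) xs
      ≡⟨ cong (_+_ (#antichains xs (suc k)))
              (countSublists-cong (antichain? (suc k) ∘ (x ∷_)) (λ S → All.all? (x ∥?_) S ×-dec antichain? k S)
                 (λ { (x∥S ∷ ac , len) → x∥S , ac , suc-injective len }) (λ (x∥S , ac , len) → x∥S ∷ ac , cong suc len) xs) ⟩
    #antichains xs (suc k) + countSublists (λ S → All.all? (x ∥?_) S ×-dec antichain? k S) xs
      ≡⟨ cong (_+_ (#antichains xs (suc k))) (countSublists-filter (x ∥?_) (antichain? k) xs) ⟩
    #antichains xs (suc k) + #antichains (filter (x ∥?_) xs) k        ∎
    where open ≡-Reasoning

  module _ (∥-sym : Symmetric _∥_) where

    AllPairs-resp-↭ : ∀ {S S′} → S ↭ S′ → AllPairs _∥_ S → AllPairs _∥_ S′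
    AllPairs-resp-↭ ↭.refl ac = ac
    AllPairs-resp-↭ (prep x σ) (x∥S ∷ ac) = ↭.All-resp-↭ σ x∥S ∷ AllPairs-resp-↭ σ ac
    AllPairs-resp-↭ (swap x y σ) ((x∥y ∷ x∥S) ∷ y∥S ∷ ac) =
      (∥-sym x∥y ∷ ↭.All-resp-↭ σ y∥S) ∷ ↭.All-resp-↭ σ x∥S ∷ AllPairs-resp-↭ σ ac
    AllPairs-resp-↭ (↭.trans σ τ) ac = AllPairs-resp-↭ τ (AllPairs-resp-↭ σ ac)

    #antichains-↭ : ∀ {xs ys} k → xs ↭ ys → #antichains xs k ≡ #antichains ys k
    #antichains-↭ k = countSublists-↭ (antichain? k)
      (λ { σ (ac , len) → AllPairs-resp-↭ σ ac , trans (sym (↭.↭-length σ)) len })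

    #antichains-sameElements : ∀ {xs ys} k → Unique xs → Unique ys → (∀ {z} → z ∈ xs ⇔ z ∈ ys) →
                               #antichains xs k ≡ #antichains ys k
    #antichains-sameElements k !xs !ys xs≈ys = #antichains-↭ k (∼bag⇒↭ (unique∧set⇒bag !xs !ys xs≈ys))

  #antichains-chain-++ : ∀ {ys} → AllPairs (λ x y → ¬ x ∥ y) ys → ∀ xs k →
                         #antichains (ys ++ xs) (suc k) ≡
                         #antichains xs (suc k) + sum (map (λ y → #antichains (filter (y ∥?_) xs) k) ys)
  #antichains-chain-++ {[]} [] xs k = sym (+-identityʳ _)
  #antichains-chain-++ {y ∷ ys} (y∦ys ∷ chain) xs k = begin
    #antichains (y ∷ ys ++ xs) (suc k)                        ≡⟨ #antichains-∷ y (ys ++ xs) k ⟩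
    #antichains (ys ++ xs) (suc k) + #antichains (filter (y ∥?_) (ys ++ xs)) k
      ≡⟨ cong₂ _+_ (#antichains-chain-++ chain xs k) (cong (λ L → #antichains L k) filter-ys++xs) ⟩
    (#antichains xs (suc k) + Σys) + #antichains (filter (y ∥?_) xs) k
      ≡⟨ +-assoc (#antichains xs (suc k)) Σys _ ⟩
    #antichains xs (suc k) + (Σys + #antichains (filter (y ∥?_) xs) k)
      ≡⟨ cong (_+_ (#antichains xs (suc k))) (+-comm Σys _) ⟩
    #antichains xs (suc k) + (#antichains (filter (y ∥?_) xs) k + Σys) ∎
    where
      open ≡-Reasoning
      Σys : ℕ
      Σys = sum (map (λ y → #antichains (filter (y ∥?_) xs) k) ys)
      filter-ys++xs : filter (y ∥?_) (ys ++ xs) ≡ filter (y ∥?_) xs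
      filter-ys++xs = trans (filter-++ (y ∥?_) ys xs) (cong (_++ filter (y ∥?_) xs) (filter-none (y ∥?_) y∦ys))

module _ {A B : Set} {_∥_ : Rel A 0ℓ} {_∥′_ : Rel B 0ℓ} (_∥?_ : Decidable₂ _∥_) (_∥′?_ : Decidable₂ _∥′_) where
  private
    module Source = Antichains _∥?_
    module Target = Antichains _∥′?_

  #antichains-map : (f : A → B) → (∀ {x y} → x ∥ y ⇔ f x ∥′ f y) →
                    ∀ xs k → Target.#antichains (map f xs) k ≡ Source.#antichains xs k
  #antichains-map f ∥⇔∥′ xs k = trans (countSublists-map (Target.antichain? k) f xs)
    (countSublists-cong (Target.antichain? k ∘ map f) (Source.antichain? k)
      (λ {S} (ac , len) → AllPairs.map (from ∥⇔∥′) (AllPairs.map⁻ ac) , trans (sym (length-map f S)) len)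
      (λ {S} (ac , len) → AllPairs.map⁺ (AllPairs.map (to ∥⇔∥′) ac) , trans (length-map f S) len) xs)

-- Short and long roots of C_p

module _ {p : ℕ} where
  open Antichains (incomparable? {p})

  shortRoots longRoots : List (Root p)
  shortRoots = concatMap (λ i → concatMap (λ j → pairRoots i j) (allFin p)) (allFin p)
  longRoots = map long (allFin p)

  pairRoots-All : {P : Pred (Root p) 0ℓ} {i j : Fin p} → (∀ i<j → P (minus i j i<j) × P (plus i j i<j)) → All P (pairRoots i j)
  pairRoots-All {i = i} {j} P± with i Fin.<? j
  ... | yes i<j = proj₁ (P± i<j) ∷ proj₂ (P± i<j) ∷ []
  ... | no _ = []

  shortRoots-All : {P : Pred (Root p) 0ℓ} → (∀ {i j} i<j → P (minus i j i<j) × P (plus i j i<j)) → All P shortRoots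
  shortRoots-All P± = All-concatMap⁺ (λ i → All-concatMap⁺ (λ j → pairRoots-All P±) (allFin p)) (allFin p)

  ∈-pairRoots : ∀ {i j : Fin p} (i<j : toℕ i < toℕ j) → minus i j i<j ∈ pairRoots i j × plus i j i<j ∈ pairRoots i j
  ∈-pairRoots {i} {j} i<j with i Fin.<? j
  ... | no i≮j = contradiction i<j i≮j
  ... | yes i<j′ rewrite <-irrelevant i<j i<j′ = here refl , there (here refl)

  pairRoots⊆shortRoots : ∀ {i j : Fin p} {r} → r ∈ pairRoots i j → r ∈ shortRoots
  pairRoots⊆shortRoots {i} {j} r∈ = ∈-concatMap⁺ (λ i → concatMap (pairRoots i) (allFin p))
    (Any.map (λ { refl → ∈-concatMap⁺ (pairRoots i) (Any.map (λ { refl → r∈ }) (∈-allFin j)) }) (∈-allFin i))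

  shortRoots-unique : Unique shortRoots
  shortRoots-unique = concatMap-unique first (λ i → All-concatMap⁺ (λ j → pairRoots-All (λ _ → refl , refl)) (allFin p))
    (λ i → concatMap-unique second (λ j → pairRoots-All (λ _ → refl , refl)) (pairRoots-unique i) (Unique.allFin⁺ p))
    (Unique.allFin⁺ p)
    where
      first second : Root p → Fin p
      first (minus i _ _) = i
      first (plus i _ _) = i
      first (long i) = i
      second (minus _ j _) = j
      second (plus _ j _) = j
      second (long i) = i
      pairRoots-unique : ∀ i j → Unique (pairRoots i j)
      pairRoots-unique i j with i Fin.<? j
      ... | yes _ = ((λ ()) ∷ []) ∷ [] ∷ []
      ... | no _ = []

  ∈-shortRoots : ∀ {i j : Fin p} (i<j : toℕ i < toℕ j) → minus i j i<j ∈ shortRoots × plus i j i<j ∈ shortRoots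
  ∈-shortRoots i<j = pairRoots⊆shortRoots (proj₁ (∈-pairRoots i<j)) , pairRoots⊆shortRoots (proj₂ (∈-pairRoots i<j))

  incomparable-sym : Symmetric (Incomparable {p})
  incomparable-sym (μ⋠γ , γ⋠μ) = γ⋠μ , μ⋠γ

  AntichainOfType : ℕ → ℕ → List (Root p) → Set
  AntichainOfType s l S = AllPairs Incomparable S × numShort S ≡ s × numLong S ≡ l

  antichainOfType? : ∀ s l → Decidable (AntichainOfType s l)
  antichainOfType? s l S = allPairs? incomparable? S ×-dec (numShort S ≟ s) ×-dec (numLong S ≟ l)

  numShort≡sum : ∀ (S : List (Root p)) → numShort S ≡ sum (map (λ r → if isShort r then 1 else 0) S)
  numShort≡sum [] = refl
  numShort≡sum (r ∷ S) = cong (_+_ (if isShort r then 1 else 0)) (numShort≡sum S)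

  numLong≡sum : ∀ (S : List (Root p)) → numLong S ≡ sum (map (λ r → if isShort r then 0 else 1) S)
  numLong≡sum [] = refl
  numLong≡sum (r ∷ S) = cong (_+_ (if isShort r then 0 else 1)) (numLong≡sum S)

  antichainOfType-↭ : ∀ s l → ↭-Invariant (AntichainOfType s l)
  antichainOfType-↭ s l {S} {S′} σ (ac , #short , #long) =
    AllPairs-resp-↭ (λ {x} {y} → incomparable-sym {x} {y}) σ ac ,
    trans (sym (permuted numShort numShort≡sum)) #short ,
    trans (sym (permuted numLong numLong≡sum)) #long
    where
      permuted : ∀ (f : List (Root p) → ℕ) {g} → (∀ S → f S ≡ sum (map g S)) → f S ≡ f S′
      permuted f {g} f≡sum = trans (f≡sum S) (trans (sum-↭ (↭.map⁺ g σ)) (sym (f≡sum S′)))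

  IsShort : Root p → Set
  IsShort r = isShort r ≡ true

  private
    allShort-numShort : ∀ {S} → All IsShort S → numShort S ≡ length S
    allShort-numShort [] = refl
    allShort-numShort (short ∷ shorts) rewrite short = cong suc (allShort-numShort shorts)

    allShort-numLong : ∀ {S} → All IsShort S → numLong S ≡ 0
    allShort-numLong [] = refl
    allShort-numLong (short ∷ shorts) rewrite short = allShort-numLong shorts

  count-noLong : ∀ is {xs} → All IsShort xs → ∀ s →
                 countSublists (antichainOfType? s 0) (map long is ++ xs) ≡ #antichains xs s
  count-noLong [] shorts s = countSublists-congAll (antichainOfType? s 0) (antichain? s)
    (λ shortS (ac , #short , _) → ac , trans (sym (allShort-numShort shortS)) #short)
    (λ shortS (ac , len) → ac , trans (allShort-numShort shortS) len , allShort-numLong shortS) shorts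
  count-noLong (i ∷ is) {xs} shorts s = begin
    countSublists (antichainOfType? s 0) (long i ∷ map long is ++ xs)
      ≡⟨ countSublists-∷ (antichainOfType? s 0) (long i) (map long is ++ xs) ⟩
    countSublists (antichainOfType? s 0) (map long is ++ xs) +
    countSublists (antichainOfType? s 0 ∘ (long i ∷_)) (map long is ++ xs)
      ≡⟨ cong₂ _+_ (count-noLong is shorts s)
                   (countSublists-reject (antichainOfType? s 0 ∘ (long i ∷_)) (λ { _ (_ , _ , ()) }) (map long is ++ xs)) ⟩
    #antichains xs s + 0
      ≡⟨ +-identityʳ _ ⟩
    #antichains xs s ∎
    where open ≡-Reasoning

  count-oneLong : (∀ i i′ → ¬ Incomparable (long i) (long i′)) → ∀ is {xs} → All IsShort xs → ∀ s →
                  countSublists (antichainOfType? s 1) (map long is ++ xs) ≡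
                  sum (map (λ i → #antichains (filter (incomparable? (long i)) xs) s) is)
  count-oneLong _ [] {xs} shorts s = trans
    (countSublists-congAll (antichainOfType? s 1) none?
      (λ shortS (_ , _ , #long) → contradiction (trans (sym (allShort-numLong shortS)) #long) λ ()) (λ _ ()) shorts)
    (countSublists-reject none? (λ _ ()) xs)
    where
      none? : Decidable {A = List (Root p)} (λ _ → ⊥)
      none? _ = no λ ()
  count-oneLong longs-comparable (i ∷ is) {xs} shorts s = begin
    countSublists (antichainOfType? s 1) (long i ∷ rest)
      ≡⟨ countSublists-∷ (antichainOfType? s 1) (long i) rest ⟩
    countSublists (antichainOfType? s 1) rest + countSublists (antichainOfType? s 1 ∘ (long i ∷_)) rest
      ≡⟨ cong₂ _+_ (count-oneLong longs-comparable is shorts s) withLong ⟩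
    sum (map term is) + term i
      ≡⟨ +-comm (sum (map term is)) (term i) ⟩
    sum (map term (i ∷ is)) ∎
    where
      open ≡-Reasoning
      rest : List (Root p)
      rest = map long is ++ xs
      term : Fin p → ℕ
      term i = #antichains (filter (incomparable? (long i)) xs) s
      withLong : countSublists (antichainOfType? s 1 ∘ (long i ∷_)) rest ≡ term i
      withLong = begin
        countSublists (antichainOfType? s 1 ∘ (long i ∷_)) rest
          ≡⟨ countSublists-cong (antichainOfType? s 1 ∘ (long i ∷_))
               (λ S → All.all? (incomparable? (long i)) S ×-dec antichainOfType? s 0 S)
               (λ { (i∥S ∷ ac , #short , #long) → i∥S , ac , #short , suc-injective #long })
               (λ (i∥S , ac , #short , #long) → i∥S ∷ ac , #short , cong suc #long) rest ⟩
        countSublists (λ S → All.all? (incomparable? (long i)) S ×-dec antichainOfType? s 0 S) rest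
          ≡⟨ countSublists-filter (incomparable? (long i)) (antichainOfType? s 0) rest ⟩
        countSublists (antichainOfType? s 0) (filter (incomparable? (long i)) rest)
          ≡⟨ cong (countSublists (antichainOfType? s 0))
               (trans (filter-++ (incomparable? (long i)) (map long is) xs)
                      (cong (_++ filter (incomparable? (long i)) xs)
                            (filter-none (incomparable? (long i)) (All.map⁺ (All.universal (longs-comparable i) is))))) ⟩
        countSublists (antichainOfType? s 0) (filter (incomparable? (long i)) xs)
          ≡⟨ count-noLong [] (All.filter⁺ (incomparable? (long i)) shorts) s ⟩
        term i ∎

  private
    shortRoots-short : All IsShort shortRoots
    shortRoots-short = shortRoots-All (λ _ → refl , refl)

    longRoots-first : ∀ s l → numAntichains p s l ≡ countSublists (antichainOfType? s l) (longRoots ++ shortRoots)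
    longRoots-first s l = countSublists-↭ (antichainOfType? s l) (antichainOfType-↭ s l) (↭.++-comm shortRoots longRoots)

  numAntichains-noLong : ∀ s → numAntichains p s 0 ≡ #antichains shortRoots s
  numAntichains-noLong s = trans (longRoots-first s 0) (count-noLong (allFin p) shortRoots-short s)

  numAntichains-oneLong : (∀ i i′ → ¬ Incomparable (long i) (long i′)) → ∀ s →
                          numAntichains p s 1 ≡
                          sum (map (λ i → #antichains (filter (incomparable? (long i)) shortRoots) s) (allFin p))
  numAntichains-oneLong longs-comparable s =
    trans (longRoots-first s 1) (count-oneLong longs-comparable (allFin p) shortRoots-short s)

-- Binomial closed forms

C[_,_] : ℕ → ℕ → ℤ
C[ n , k ] = + (n C k)

pascal : ∀ n k → C[ suc n , suc k ] ≡ C[ n , k ] ℤ.+ C[ n , suc k ]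
pascal n k = trans (cong +_ (sym (nCk+nC[k+1]≡[n+1]C[k+1] n k))) (ℤ.pos-+ (n C k) (n C suc k))

-- For a ≤ b, rowCount a b (suc k) counts the (k+1)-antichains of trapezoid (suc a) b meeting its top row.
rowCount : ℕ → ℕ → ℕ → ℤ
rowCount a b j = C[ suc a , j ] ℤ.* C[ b , j ] ℤ.- C[ a , j ] ℤ.* C[ suc b , j ]

trapezoidCount : ℕ → ℕ → ℕ → ℤ
trapezoidCount a b k = C[ suc a , suc k ] ℤ.* C[ b , k ] ℤ.- C[ a , suc k ] ℤ.* C[ suc b , k ]

rowCount-diagonal : ∀ a j → rowCount a a j ≡ 0ℤ
rowCount-diagonal a j =
  trans (cong (ℤ._-_ (C[ suc a , j ] ℤ.* C[ a , j ])) (ℤ.*-comm C[ a , j ] C[ suc a , j ]))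
        (ℤ.+-inverseʳ (C[ suc a , j ] ℤ.* C[ a , j ]))

-- Pascal's rule is substituted into variables standing for the binomials, leaving a ring identity.
rowCount-suc : ∀ a b k → rowCount a (suc b) (suc k) ≡ rowCount a b (suc k) ℤ.+ trapezoidCount a b k
rowCount-suc a b k =
  expand C[ suc a , suc k ] C[ a , suc k ] C[ b , k ] C[ b , suc k ] C[ suc b , k ] (pascal b k) (pascal (suc b) k)
  where
    expand : ∀ x y u v w {s t} → s ≡ u ℤ.+ v → t ≡ w ℤ.+ s →
             x ℤ.* s ℤ.- y ℤ.* t ≡ (x ℤ.* v ℤ.- y ℤ.* s) ℤ.+ (x ℤ.* u ℤ.- y ℤ.* w)
    expand x y u v w refl refl = identity x y u v w
      where
        identity : ∀ x y u v w → x ℤ.* (u ℤ.+ v) ℤ.- y ℤ.* (w ℤ.+ (u ℤ.+ v)) ≡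
                                 (x ℤ.* v ℤ.- y ℤ.* (u ℤ.+ v)) ℤ.+ (x ℤ.* u ℤ.- y ℤ.* w)
        identity = solve-∀

trapezoidCount-zero : ∀ a b → trapezoidCount a b 0 ≡ 1ℤ
trapezoidCount-zero a b =
  trans (cong₂ (λ x y → x ℤ.* 1ℤ ℤ.- y ℤ.* 1ℤ) (cong +_ (nC1≡n (suc a))) (cong +_ (nC1≡n a))) (identity (+ a))
  where
    identity : ∀ y → (1ℤ ℤ.+ y) ℤ.* 1ℤ ℤ.- y ℤ.* 1ℤ ≡ 1ℤ
    identity = solve-∀

trapezoidCount-suc : ∀ a b k → trapezoidCount (suc a) b (suc k) ≡ trapezoidCount a b (suc k) ℤ.+ rowCount a b (suc k)
trapezoidCount-suc a b k =
  expand C[ suc a , suc k ] C[ a , suc k ] C[ a , suc (suc k) ] C[ b , suc k ] C[ suc b , suc k ]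
         (pascal (suc a) (suc k)) (pascal a (suc k))
  where
    expand : ∀ x y z v w {s t} → t ≡ x ℤ.+ s → s ≡ y ℤ.+ z →
             t ℤ.* v ℤ.- s ℤ.* w ≡ (s ℤ.* v ℤ.- z ℤ.* w) ℤ.+ (x ℤ.* v ℤ.- y ℤ.* w)
    expand x y z v w refl refl = identity x y z v w
      where
        identity : ∀ x y z v w → (x ℤ.+ (y ℤ.+ z)) ℤ.* v ℤ.- (y ℤ.+ z) ℤ.* w ≡
                                 ((y ℤ.+ z) ℤ.* v ℤ.- z ℤ.* w) ℤ.+ (x ℤ.* v ℤ.- y ℤ.* w)
        identity = solve-∀

m+[n-m]≡n : ∀ m n → m ℤ.+ (n ℤ.- m) ≡ n
m+[n-m]≡n = solve-∀

-- Staircases of lattice points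

Pair : Set
Pair = ℕ × ℕ

_<×<_ : Rel Pair 0ℓ
(a , b) <×< (c , d) = a < c × b < d

Staggered : Rel Pair 0ℓ
Staggered z w = z <×< w ⊎ w <×< z

staggered? : Decidable₂ Staggered
staggered? (a , b) (c , d) = ((a <? c) ×-dec (b <? d)) ⊎-dec ((c <? a) ×-dec (d <? b))

staggered-sym : Symmetric Staggered
staggered-sym (inj₁ z<w) = inj₂ z<w
staggered-sym (inj₂ w<z) = inj₁ w<z

open Antichains staggered?

row : ℕ → ℕ → List Pair
row x zero = []
row x (suc w) = (x , suc (x + w)) ∷ row x w

staircase : ℕ → (ℕ → ℕ) → List Pair
staircase zero top = []
staircase (suc m) top = row m (top m ∸ m) ++ staircase m top

trapezoid : ℕ → ℕ → List Pair
trapezoid a b = staircase a (λ _ → b)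

InStaircase : ℕ → (ℕ → ℕ) → Pair → Set
InStaircase n top (x , y) = x < n × x < y × y ≤ top x

∈-row⁻ : ∀ {x w z} → z ∈ row x w → proj₁ z ≡ x × x < proj₂ z × proj₂ z ≤ x + w
∈-row⁻ {x} {suc w} (here refl) = refl , s≤s (m≤m+n x w) , ≤-reflexive (sym (+-suc x w))
∈-row⁻ {x} {suc w} (there z∈row) with ∈-row⁻ z∈row
... | x′≡x , x<y , y≤x+w = x′≡x , x<y , ≤-trans y≤x+w (+-monoʳ-≤ x (n≤1+n w))

∈-row⁺ : ∀ {x w y} → x < y → y ≤ x + w → (x , y) ∈ row x w
∈-row⁺ {x} {zero} {y} x<y y≤x+0 = contradiction (subst (y ≤_) (+-identityʳ x) y≤x+0) (<⇒≱ x<y)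
∈-row⁺ {x} {suc w} {y} x<y y≤x+1+w with m≤n⇒m<n∨m≡n (subst (y ≤_) (+-suc x w) y≤x+1+w)
... | inj₁ y<1+x+w = there (∈-row⁺ x<y (s≤s⁻¹ y<1+x+w))
... | inj₂ refl = here refl

row-unique : ∀ x w → Unique (row x w)
row-unique x zero = []
row-unique x (suc w) =
  All.tabulate (λ z∈row eq → <-irrefl (sym (cong proj₂ eq)) (s≤s (proj₂ (proj₂ (∈-row⁻ z∈row))))) ∷ row-unique x w

row-chain : ∀ x w → AllPairs (λ u v → ¬ Staggered u v) (row x w)
row-chain x zero = []
row-chain x (suc w) = All.tabulate (λ z∈row → not-staggered (proj₁ (∈-row⁻ z∈row))) ∷ row-chain x w
  where
    not-staggered : ∀ {z} → proj₁ z ≡ x → ¬ Staggered (x , suc (x + w)) z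
    not-staggered refl (inj₁ (x<x , _)) = <-irrefl refl x<x
    not-staggered refl (inj₂ (x<x , _)) = <-irrefl refl x<x

private
  below-top : ∀ {m y t} → m < y → y ≤ m + (t ∸ m) → y ≤ t
  below-top {m} {y} {t} m<y y≤ with ≤-total m t
  ... | inj₁ m≤t = subst (y ≤_) (m+[n∸m]≡n m≤t) y≤
  ... | inj₂ t≤m = contradiction (subst (y ≤_) (trans (cong (_+_ m) (m≤n⇒m∸n≡0 t≤m)) (+-identityʳ m)) y≤) (<⇒≱ m<y)

∈-staircase⁻ : ∀ {n top z} → z ∈ staircase n top → InStaircase n top z
∈-staircase⁻ {suc m} {top} z∈ with ∈-++⁻ (row m (top m ∸ m)) z∈
... | inj₁ z∈row with ∈-row⁻ z∈row
...   | refl , m<y , y≤ = n<1+n m , m<y , below-top m<y y≤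
∈-staircase⁻ {suc m} {top} z∈ | inj₂ z∈rest with ∈-staircase⁻ {m} z∈rest
... | x<m , x<y , y≤top = m≤n⇒m≤1+n x<m , x<y , y≤top

∈-staircase⁺ : ∀ {n top z} → InStaircase n top z → z ∈ staircase n top
∈-staircase⁺ {suc m} {top} {x , y} (x<1+m , x<y , y≤top) with m≤n⇒m<n∨m≡n (s≤s⁻¹ x<1+m)
... | inj₁ x<m = ∈-++⁺ʳ (row m (top m ∸ m)) (∈-staircase⁺ (x<m , x<y , y≤top))
... | inj₂ refl = ∈-++⁺ˡ (∈-row⁺ x<y (≤-trans y≤top (m≤n+m∸n (top x) x)))

staircase-unique : ∀ n top → Unique (staircase n top)
staircase-unique zero top = []
staircase-unique (suc m) top = Unique.++⁺ (row-unique m (top m ∸ m)) (staircase-unique m top)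
  (λ (z∈row , z∈rest) → <-irrefl (proj₁ (∈-row⁻ z∈row)) (proj₁ (∈-staircase⁻ {m} z∈rest)))

Enumerates : List Pair → ℕ → (ℕ → ℕ) → Set
Enumerates xs n top = Unique xs × (∀ {z} → z ∈ xs ⇔ InStaircase n top z)

staircase-enumerates : ∀ n top → Enumerates (staircase n top) n top
staircase-enumerates n top = staircase-unique n top , mk⇔ ∈-staircase⁻ ∈-staircase⁺

#antichains-enumeration : ∀ {xs n top} k → Enumerates xs n top → #antichains xs k ≡ #antichains (staircase n top) k
#antichains-enumeration {n = n} {top} k (!xs , ∈xs⇔) =
  #antichains-sameElements staggered-sym k !xs (staircase-unique n top) (mk⇔ (∈-staircase⁺ ∘ to ∈xs⇔) (from ∈xs⇔ ∘ ∈-staircase⁻))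

#antichains-filter-staggered : ∀ {xs n top m c} k → Enumerates xs n top →
                               m ≤ n → (∀ {x} → x < m → c ≤ top x) → (∀ {x} → m < x → x < n → top x ≤ c) →
                               #antichains (filter (staggered? (m , suc c)) xs) k ≡ #antichains (trapezoid m c) k
#antichains-filter-staggered {xs} {n} {top} {m} {c} k (!xs , ∈xs⇔) m≤n c≤top top≤c =
  #antichains-enumeration k (Unique.filter⁺ (staggered? (m , suc c)) !xs , mk⇔ below above)
  where
    below : ∀ {z} → z ∈ filter (staggered? (m , suc c)) xs → InStaircase m (λ _ → c) z
    below z∈ with ∈-filter⁻ (staggered? (m , suc c)) z∈
    ... | z∈xs , inj₂ (x<m , y<1+c) = x<m , proj₁ (proj₂ (to ∈xs⇔ z∈xs)) , s≤s⁻¹ y<1+c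
    ... | z∈xs , inj₁ (m<x , 1+c<y) with to ∈xs⇔ z∈xs
    ...   | x<n , _ , y≤top = contradiction (≤-trans y≤top (top≤c m<x x<n)) (<⇒≱ (<-trans (n<1+n c) 1+c<y))
    above : ∀ {z} → InStaircase m (λ _ → c) z → z ∈ filter (staggered? (m , suc c)) xs
    above (x<m , x<y , y≤c) =
      ∈-filter⁺ (staggered? (m , suc c)) (from ∈xs⇔ (<-≤-trans x<m m≤n , x<y , ≤-trans y≤c (c≤top x<m))) (inj₂ (x<m , s≤s y≤c))

#antichains-staircase-suc : ∀ {m top} k → m ≤ top m → (∀ {x} → x < m → top m ≤ top x) →
                            (∀ {c} → m ≤ c → + #antichains (trapezoid m c) k ≡ trapezoidCount m c k) →
                            + #antichains (staircase (suc m) top) (suc k) ≡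
                            + #antichains (staircase m top) (suc k) ℤ.+ rowCount m (top m) (suc k)
#antichains-staircase-suc {m} {top} k m≤top antitone trapezoid-counts = begin
  + #antichains (row m (top m ∸ m) ++ staircase m top) (suc k)
    ≡⟨ cong +_ (#antichains-chain-++ (row-chain m (top m ∸ m)) (staircase m top) k) ⟩
  + (#antichains (staircase m top) (suc k) + sum (map rowTerm (row m (top m ∸ m))))
    ≡⟨ ℤ.pos-+ (#antichains (staircase m top) (suc k)) _ ⟩
  + #antichains (staircase m top) (suc k) ℤ.+ + sum (map rowTerm (row m (top m ∸ m)))
    ≡⟨ cong (ℤ._+_ (+ #antichains (staircase m top) (suc k))) (row-sum (top m ∸ m) ≤-refl) ⟩
  + #antichains (staircase m top) (suc k) ℤ.+ rowCount m (m + (top m ∸ m)) (suc k)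
    ≡⟨ cong (λ b → + #antichains (staircase m top) (suc k) ℤ.+ rowCount m b (suc k)) (m+[n∸m]≡n m≤top) ⟩
  + #antichains (staircase m top) (suc k) ℤ.+ rowCount m (top m) (suc k) ∎
  where
    open ≡-Reasoning
    rowTerm : Pair → ℕ
    rowTerm y = #antichains (filter (staggered? y) (staircase m top)) k
    rowTerm-trapezoid : ∀ {c} → c < top m → rowTerm (m , suc c) ≡ #antichains (trapezoid m c) k
    rowTerm-trapezoid c<top = #antichains-filter-staggered k (staircase-enumerates m top) ≤-refl
      (λ x<m → ≤-trans (<⇒≤ c<top) (antitone x<m)) (λ m<x x<m → contradiction m<x (<-asym x<m))
    row-sum : ∀ d → d ≤ top m ∸ m → + sum (map rowTerm (row m d)) ≡ rowCount m (m + d) (suc k)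
    row-sum zero _ = sym (trans (cong (λ b → rowCount m b (suc k)) (+-identityʳ m)) (rowCount-diagonal m (suc k)))
    row-sum (suc d) d<w = begin
      + (rowTerm (m , suc (m + d)) + sum (map rowTerm (row m d)))
        ≡⟨ ℤ.pos-+ (rowTerm (m , suc (m + d))) _ ⟩
      + rowTerm (m , suc (m + d)) ℤ.+ + sum (map rowTerm (row m d))
        ≡⟨ cong₂ ℤ._+_ (trans (cong +_ (rowTerm-trapezoid m+d<top)) (trapezoid-counts (m≤m+n m d))) (row-sum d (<⇒≤ d<w)) ⟩
      trapezoidCount m (m + d) k ℤ.+ rowCount m (m + d) (suc k)
        ≡⟨ ℤ.+-comm (trapezoidCount m (m + d) k) _ ⟩
      rowCount m (m + d) (suc k) ℤ.+ trapezoidCount m (m + d) k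
        ≡⟨ rowCount-suc m (m + d) k ⟨
      rowCount m (suc (m + d)) (suc k)
        ≡⟨ cong (λ b → rowCount m b (suc k)) (+-suc m d) ⟨
      rowCount m (m + suc d) (suc k) ∎
      where
        m+d<top : m + d < top m
        m+d<top = <-≤-trans (+-monoʳ-< m d<w) (≤-reflexive (m+[n∸m]≡n m≤top))

#antichains-trapezoid : ∀ a b k → a ≤ b → + #antichains (trapezoid a b) k ≡ trapezoidCount a b k
#antichains-trapezoid a b zero _ = trans (cong +_ (#antichains-zero (trapezoid a b))) (sym (trapezoidCount-zero a b))
#antichains-trapezoid zero b (suc k) _ = refl
#antichains-trapezoid (suc a) b (suc k) 1+a≤b = begin
  + #antichains (trapezoid (suc a) b) (suc k)
    ≡⟨ #antichains-staircase-suc k (<⇒≤ 1+a≤b) (λ _ → ≤-refl) (λ {c} a≤c → #antichains-trapezoid a c k a≤c) ⟩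
  + #antichains (trapezoid a b) (suc k) ℤ.+ rowCount a b (suc k)
    ≡⟨ cong (ℤ._+ rowCount a b (suc k)) (#antichains-trapezoid a b (suc k) (<⇒≤ 1+a≤b)) ⟩
  trapezoidCount a b (suc k) ℤ.+ rowCount a b (suc k)
    ≡⟨ trapezoidCount-suc a b k ⟨
  trapezoidCount (suc a) b (suc k) ∎
  where open ≡-Reasoning

_⊑_ : Rel Pair 0ℓ
(a , b) ⊑ (c , d) = c ≤ a × b ≤ d

staggered⇔incomparable : ∀ {z w} → Staggered z w ⇔ (¬ z ⊑ w × ¬ w ⊑ z)
staggered⇔incomparable {a , b} {c , d} = mk⇔ incomparable staggered
  where
    incomparable : Staggered (a , b) (c , d) → ¬ (a , b) ⊑ (c , d) × ¬ (c , d) ⊑ (a , b)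
    incomparable (inj₁ (a<c , b<d)) = (λ (c≤a , _) → <⇒≱ a<c c≤a) , (λ (_ , d≤b) → <⇒≱ b<d d≤b)
    incomparable (inj₂ (c<a , d<b)) = (λ (_ , b≤d) → <⇒≱ d<b b≤d) , (λ (a≤c , _) → <⇒≱ c<a a≤c)
    staggered : ¬ (a , b) ⊑ (c , d) × ¬ (c , d) ⊑ (a , b) → Staggered (a , b) (c , d)
    staggered (z⋢w , w⋢z) with <-cmp a c
    ... | tri< a<c _ _ = inj₁ (a<c , ≰⇒> (λ d≤b → w⋢z (<⇒≤ a<c , d≤b)))
    ... | tri> _ _ c<a = inj₂ (c<a , ≰⇒> (λ b≤d → z⋢w (<⇒≤ c<a , b≤d)))
    ... | tri≈ _ refl _ with ≤-total b d
    ...   | inj₁ b≤d = contradiction (≤-refl , b≤d) z⋢w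
    ...   | inj₂ d≤b = contradiction (≤-refl , d≤b) w⋢z

module ShortStaircase (q : ℕ) where

  -- (a , b) is the interval of a short root of C_{q+1} iff a < b ≤ shortTop a, and belowLong m holds
  -- the intervals of the short roots incomparable with the long root 2e_m.
  shortTop : ℕ → ℕ
  shortTop x = (q + q) ∸ x

  belowLong : ℕ → List Pair
  belowLong m = trapezoid m (shortTop m)

  ≤q⇒≤q+q : ∀ {x} → x ≤ q → x ≤ q + q
  ≤q⇒≤q+q x≤q = ≤-trans x≤q (m≤m+n q q)

  q≤shortTop : ∀ {t} → t ≤ q → q ≤ shortTop t
  q≤shortTop {t} t≤q = m+n≤o⇒m≤o∸n q (+-monoʳ-≤ q t≤q)

  shortTop-mono : ∀ {x y} → x ≤ y → shortTop y ≤ shortTop x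
  shortTop-mono = ∸-monoʳ-≤ (q + q)

  shortTop-strict : ∀ {x y} → x < y → y ≤ q + q → shortTop y < shortTop x
  shortTop-strict = ∸-monoʳ-<

  shortTop-involutive : ∀ {c} → c ≤ q + q → shortTop (shortTop c) ≡ c
  shortTop-involutive = m∸[m∸n]≡n

  ≤-shortTop-swap : ∀ {a c} → a ≤ q + q → c ≤ shortTop a → a ≤ shortTop c
  ≤-shortTop-swap {a} {c} a≤ c≤ = m+n≤o⇒m≤o∸n a (≤-trans (+-monoʳ-≤ a c≤) (≤-reflexive (m+[n∸m]≡n a≤)))

  <-shortTop-swap : ∀ {a c} → a ≤ q + q → c < shortTop a → a < shortTop c
  <-shortTop-swap {a} {c} a≤ c< = m+n≤o⇒m≤o∸n (suc a)
    (≤-trans (≤-reflexive (sym (+-suc a c))) (≤-trans (+-monoʳ-≤ a c<) (≤-reflexive (m+[n∸m]≡n a≤))))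

  private
    C[1+shortTop] : ∀ {m} j → m ≤ q → C[ suc (q + q) ∸ m , j ] ≡ C[ suc (shortTop m) , j ]
    C[1+shortTop] j m≤q = cong (λ n → C[ n , j ]) (+-∸-assoc 1 (≤q⇒≤q+q m≤q))

  shortStaircase-count : ∀ m k → m ≤ suc q →
                         + #antichains (staircase m shortTop) (suc k) ≡ C[ m , suc k ] ℤ.* C[ suc (q + q) ∸ m , suc k ]
  shortStaircase-count zero k _ = refl
  shortStaircase-count (suc m) k 1+m≤1+q = begin
    + #antichains (staircase (suc m) shortTop) (suc k)
      ≡⟨ #antichains-staircase-suc k (≤-trans m≤q (q≤shortTop m≤q)) (shortTop-mono ∘ <⇒≤) (λ {c} → #antichains-trapezoid m c k) ⟩
    + #antichains (staircase m shortTop) (suc k) ℤ.+ rowCount m (shortTop m) (suc k)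
      ≡⟨ cong (ℤ._+ rowCount m (shortTop m) (suc k)) (shortStaircase-count m k (m≤n⇒m≤1+n m≤q)) ⟩
    C[ m , suc k ] ℤ.* C[ suc (q + q) ∸ m , suc k ] ℤ.+ rowCount m (shortTop m) (suc k)
      ≡⟨ cong (λ c → C[ m , suc k ] ℤ.* c ℤ.+ rowCount m (shortTop m) (suc k)) (C[1+shortTop] (suc k) m≤q) ⟩
    C[ m , suc k ] ℤ.* C[ suc (shortTop m) , suc k ] ℤ.+ rowCount m (shortTop m) (suc k)
      ≡⟨ m+[n-m]≡n (C[ m , suc k ] ℤ.* C[ suc (shortTop m) , suc k ]) _ ⟩
    C[ suc m , suc k ] ℤ.* C[ shortTop m , suc k ] ∎
    where
      open ≡-Reasoning
      m≤q : m ≤ q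
      m≤q = s≤s⁻¹ 1+m≤1+q

  belowLong-sum-count : ∀ m k → m ≤ suc q →
                        + sum (applyUpTo (λ x → #antichains (belowLong x) k) m) ≡ C[ m , suc k ] ℤ.* C[ suc (q + q) ∸ m , k ]
  belowLong-sum-count zero k _ = refl
  belowLong-sum-count (suc m) k 1+m≤1+q = begin
    + sum (applyUpTo term (suc m))
      ≡⟨ cong (+_ ∘ sum) (applyUpTo-∷ʳ term m) ⟨
    + sum (applyUpTo term m ++ term m ∷ [])
      ≡⟨ cong +_ (trans (sum-++ (applyUpTo term m) _) (cong (_+_ (sum (applyUpTo term m))) (+-identityʳ (term m)))) ⟩
    + (sum (applyUpTo term m) + term m)
      ≡⟨ ℤ.pos-+ (sum (applyUpTo term m)) (term m) ⟩
    + sum (applyUpTo term m) ℤ.+ + term m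
      ≡⟨ cong₂ ℤ._+_ (belowLong-sum-count m k (m≤n⇒m≤1+n m≤q))
                     (#antichains-trapezoid m (shortTop m) k (≤-trans m≤q (q≤shortTop m≤q))) ⟩
    C[ m , suc k ] ℤ.* C[ suc (q + q) ∸ m , k ] ℤ.+ trapezoidCount m (shortTop m) k
      ≡⟨ cong (λ c → C[ m , suc k ] ℤ.* c ℤ.+ trapezoidCount m (shortTop m) k) (C[1+shortTop] k m≤q) ⟩
    C[ m , suc k ] ℤ.* C[ suc (shortTop m) , k ] ℤ.+ trapezoidCount m (shortTop m) k
      ≡⟨ m+[n-m]≡n (C[ m , suc k ] ℤ.* C[ suc (shortTop m) , k ]) _ ⟩
    C[ suc m , suc k ] ℤ.* C[ shortTop m , k ] ∎
    where
      open ≡-Reasoning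
      m≤q : m ≤ q
      m≤q = s≤s⁻¹ 1+m≤1+q
      term : ℕ → ℕ
      term x = #antichains (belowLong x) k

  #antichains-shortStaircase : ∀ k → #antichains (staircase (suc q) shortTop) k ≡ (suc q C k) * (q C k)
  #antichains-shortStaircase zero = #antichains-zero (staircase (suc q) shortTop)
  #antichains-shortStaircase (suc k) = ℤ.+-injective (begin
    + #antichains (staircase (suc q) shortTop) (suc k)   ≡⟨ shortStaircase-count (suc q) k ≤-refl ⟩
    C[ suc q , suc k ] ℤ.* C[ (q + q) ∸ q , suc k ]      ≡⟨ cong (λ n → C[ suc q , suc k ] ℤ.* C[ n , suc k ]) (m+n∸n≡m q q) ⟩
    C[ suc q , suc k ] ℤ.* C[ q , suc k ]                ≡⟨ ℤ.pos-* (suc q C suc k) (q C suc k) ⟨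
    + ((suc q C suc k) * (q C suc k))                     ∎)
    where open ≡-Reasoning

  sum-#antichains-belowLong : ∀ k → sum (applyUpTo (λ x → #antichains (belowLong x) k) (suc q)) ≡ (suc q C suc k) * (q C k)
  sum-#antichains-belowLong k = ℤ.+-injective (begin
    + sum (applyUpTo (λ x → #antichains (belowLong x) k) (suc q))   ≡⟨ belowLong-sum-count (suc q) k ≤-refl ⟩
    C[ suc q , suc k ] ℤ.* C[ (q + q) ∸ q , k ]      ≡⟨ cong (λ n → C[ suc q , suc k ] ℤ.* C[ n , k ]) (m+n∸n≡m q q) ⟩
    C[ suc q , suc k ] ℤ.* C[ q , k ]                ≡⟨ ℤ.pos-* (suc q C suc k) (q C k) ⟨
    + ((suc q C suc k) * (q C k))                     ∎)
    where open ≡-Reasoning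

-- Roots of C_{q+1} as intervals

module RootsAsIntervals (q : ℕ) where
  open ShortStaircase q
  private module Roots = Antichains (incomparable? {suc q})

  longEnd : Fin (suc q) → ℕ
  longEnd j = suc (shortTop (toℕ j))

  interval : Root (suc q) → Pair
  interval (minus i j _) = toℕ i , toℕ j
  interval (plus i j _) = toℕ i , longEnd j
  interval (long i) = toℕ i , longEnd i

  private
    <ᵇ-true : ∀ {m n} → m < n → (m <ᵇ n) ≡ true
    <ᵇ-true {zero} {suc n} _ = refl
    <ᵇ-true {suc m} {suc n} (s≤s m<n) = <ᵇ-true m<n

    <ᵇ-false : ∀ {m n} → n ≤ m → (m <ᵇ n) ≡ false
    <ᵇ-false {m} {zero} _ = refl
    <ᵇ-false {suc m} {suc n} (s≤s n≤m) = <ᵇ-false n≤m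

  cover : ℕ → ℕ → ℕ → ℕ
  cover a b t = if t <ᵇ a then 0 else if t <ᵇ b then 1 else 0

  cover-below : ∀ {a b t} → t < a → cover a b t ≡ 0
  cover-below t<a rewrite <ᵇ-true t<a = refl

  cover-inside : ∀ {a b t} → a ≤ t → t < b → cover a b t ≡ 1
  cover-inside a≤t t<b rewrite <ᵇ-false a≤t | <ᵇ-true t<b = refl

  cover-above : ∀ {a b t} → b ≤ t → cover a b t ≡ 0
  cover-above {a} {b} {t} b≤t with t <ᵇ a
  ... | true = refl
  ... | false rewrite <ᵇ-false b≤t = refl

  cover-≤1 : ∀ a b t → cover a b t ≤ 1
  cover-≤1 a b t with t <ᵇ a | t <ᵇ b
  ... | true | _ = z≤n
  ... | false | true = s≤s z≤n
  ... | false | false = z≤n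

  cover-mono : ∀ {a b c d} t → c ≤ a → b ≤ d → cover a b t ≤ cover c d t
  cover-mono {a} {b} {c} {d} t c≤a b≤d with t <? a | t <? b
  ... | yes t<a | _ rewrite cover-below {a} {b} t<a = z≤n
  ... | no t≮a | no t≮b rewrite cover-above {a} {b} (≮⇒≥ t≮b) = z≤n
  ... | no t≮a | yes t<b
    rewrite cover-inside (≮⇒≥ t≮a) t<b | cover-inside (≤-trans c≤a (≮⇒≥ t≮a)) (<-≤-trans t<b b≤d) = ≤-refl

  mirrorCover : Pair → ℕ → ℕ
  mirrorCover (a , b) t = if t <ᵇ q then cover a b (shortTop t) else 0

  multiplicity : Pair → ℕ → ℕ
  multiplicity (a , b) t = cover a b t + mirrorCover (a , b) t

  mirrorCover-vanishes : ∀ {a b t} → b ≤ shortTop t → mirrorCover (a , b) t ≡ 0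
  mirrorCover-vanishes {a} {b} {t} b≤ with t <ᵇ q
  ... | true = cover-above {a} b≤
  ... | false = refl

  mirrorCover-inside : ∀ {a b t} → t < q → a ≤ shortTop t → shortTop t < b → mirrorCover (a , b) t ≡ 1
  mirrorCover-inside t<q a≤ <b rewrite <ᵇ-true t<q = cover-inside a≤ <b

  mirrorCover-middle : ∀ {a b t} → q ≤ t → mirrorCover (a , b) t ≡ 0
  mirrorCover-middle q≤t rewrite <ᵇ-false q≤t = refl

  private
    if-true : ∀ {b} {x y : ℕ} → b ≡ true → (if b then x else y) ≡ x
    if-true refl = refl

    if-false : ∀ {b} {x y : ℕ} → b ≡ false → (if b then x else y) ≡ y
    if-false refl = refl

    fin≤q : (i : Fin (suc q)) → toℕ i ≤ q
    fin≤q i = s≤s⁻¹ (toℕ<n i)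

    cover-longEnd : ∀ a j (k : Fin (suc q)) → a ≤ toℕ k → cover a (longEnd j) (toℕ k) ≡ 1
    cover-longEnd a j k a≤t = cover-inside a≤t (s≤s (≤-trans (fin≤q k) (q≤shortTop (fin≤q j))))

    mirror-before-longEnd : ∀ a j (k : Fin (suc q)) → toℕ k < toℕ j → mirrorCover (a , longEnd j) (toℕ k) ≡ 0
    mirror-before-longEnd a j k t<j = mirrorCover-vanishes {a} (shortTop-strict t<j (≤q⇒≤q+q (fin≤q j)))

    mirror-after-longEnd : ∀ a j (k : Fin (suc q)) → a ≤ q → toℕ j ≤ toℕ k → toℕ k < q →
                           mirrorCover (a , longEnd j) (toℕ k) ≡ 1
    mirror-after-longEnd a j k a≤q j≤t t<q = mirrorCover-inside t<q (≤-trans a≤q (q≤shortTop (fin≤q k))) (s≤s (shortTop-mono j≤t))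

  coeff-interval : ∀ r k → coeff r k ≡ multiplicity (interval r) (toℕ k)
  coeff-interval (minus i j _) k =
    sym (trans (cong (_+_ (cover (toℕ i) (toℕ j) (toℕ k))) (mirrorCover-vanishes {toℕ i} (≤-trans (fin≤q j) (q≤shortTop (fin≤q k)))))
               (+-identityʳ _))
  coeff-interval (plus i j i<j) k with toℕ k <? toℕ i | toℕ k <? toℕ j | toℕ k <? q
  ... | yes t<i | _ | _ =
    trans (if-true (<ᵇ-true t<i))
      (sym (cong₂ _+_ (cover-below {b = longEnd j} t<i) (mirror-before-longEnd (toℕ i) j k (<-trans t<i i<j))))
  ... | no t≮i | yes t<j | _ =
    trans (if-false (<ᵇ-false (≮⇒≥ t≮i))) (trans (if-true (<ᵇ-true t<j))
      (sym (cong₂ _+_ (cover-longEnd (toℕ i) j k (≮⇒≥ t≮i)) (mirror-before-longEnd (toℕ i) j k t<j))))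
  ... | no t≮i | no t≮j | yes t<q =
    trans (if-false (<ᵇ-false (≮⇒≥ t≮i))) (trans (if-false (<ᵇ-false (≮⇒≥ t≮j))) (trans (if-true (<ᵇ-true t<q))
      (sym (cong₂ _+_ (cover-longEnd (toℕ i) j k (≮⇒≥ t≮i)) (mirror-after-longEnd (toℕ i) j k (fin≤q i) (≮⇒≥ t≮j) t<q)))))
  ... | no t≮i | no t≮j | no t≮q =
    trans (if-false (<ᵇ-false (≮⇒≥ t≮i))) (trans (if-false (<ᵇ-false (≮⇒≥ t≮j))) (trans (if-false (<ᵇ-false (≮⇒≥ t≮q)))
      (sym (cong₂ _+_ (cover-longEnd (toℕ i) j k (≮⇒≥ t≮i)) (mirrorCover-middle {toℕ i} {longEnd j} (≮⇒≥ t≮q))))))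
  coeff-interval (long i) k with toℕ k <? toℕ i | toℕ k <? q
  ... | yes t<i | _ =
    trans (if-true (<ᵇ-true t<i))
      (sym (cong₂ _+_ (cover-below {b = longEnd i} t<i) (mirror-before-longEnd (toℕ i) i k t<i)))
  ... | no t≮i | yes t<q =
    trans (if-false (<ᵇ-false (≮⇒≥ t≮i))) (trans (if-true (<ᵇ-true t<q))
      (sym (cong₂ _+_ (cover-longEnd (toℕ i) i k (≮⇒≥ t≮i)) (mirror-after-longEnd (toℕ i) i k (fin≤q i) (≮⇒≥ t≮i) t<q))))
  ... | no t≮i | no t≮q =
    trans (if-false (<ᵇ-false (≮⇒≥ t≮i))) (trans (if-false (<ᵇ-false (≮⇒≥ t≮q)))
      (sym (cong₂ _+_ (cover-longEnd (toℕ i) i k (≮⇒≥ t≮i)) (mirrorCover-middle {toℕ i} {longEnd i} (≮⇒≥ t≮q)))))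

  multiplicity-mono : ∀ {z w} → z ⊑ w → ∀ t → multiplicity z t ≤ multiplicity w t
  multiplicity-mono {a , b} {c , d} (c≤a , b≤d) t = +-mono-≤ (cover-mono t c≤a b≤d) mirror-mono
    where
      mirror-mono : mirrorCover (a , b) t ≤ mirrorCover (c , d) t
      mirror-mono with t <ᵇ q
      ... | true = cover-mono (shortTop t) c≤a b≤d
      ... | false = z≤n

  ValidInterval : Pair → Set
  ValidInterval (a , b) = a ≤ q × a < b × b ≤ suc (shortTop a)

  interval-valid : ∀ r → ValidInterval (interval r)
  interval-valid (minus i j i<j) = fin≤q i , i<j , ≤-trans (fin≤q j) (≤-trans (q≤shortTop (fin≤q i)) (n≤1+n _))
  interval-valid (plus i j i<j) = fin≤q i , s≤s (≤-trans (fin≤q i) (q≤shortTop (fin≤q j))) , s≤s (shortTop-mono (<⇒≤ i<j))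
  interval-valid (long i) = fin≤q i , s≤s (≤-trans (fin≤q i) (q≤shortTop (fin≤q i))) , ≤-refl

  private
    multiplicity-pos : ∀ {a b t} → a ≤ t → t < b → 1 ≤ multiplicity (a , b) t
    multiplicity-pos a≤t t<b = ≤-trans (≤-reflexive (sym (cover-inside a≤t t<b))) (m≤m+n _ _)

    start-reflected : ∀ {a b c d} → ValidInterval (a , b) → ValidInterval (c , d) →
                      multiplicity (a , b) a ≤ multiplicity (c , d) a → c ≤ a
    start-reflected {a} {b} {c} {d} (_ , a<b , _) (c≤q , _ , d≤) le = ≮⇒≥ λ a<c →
      contradiction (≤-trans (multiplicity-pos ≤-refl a<b) (≤-trans le (≤-reflexive (absent a<c)))) λ ()
      where
        absent : a < c → multiplicity (c , d) a ≡ 0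
        absent a<c = cong₂ _+_ (cover-below {b = d} a<c)
                               (mirrorCover-vanishes {c} (≤-trans d≤ (shortTop-strict a<c (≤q⇒≤q+q c≤q))))

    end-reflected : ∀ {a b c d} → ValidInterval (a , b) → ValidInterval (c , d) →
                    (∀ t → t ≤ q → multiplicity (a , b) t ≤ multiplicity (c , d) t) → b ≤ d
    end-reflected {a} {suc b} {c} {d} (a≤q , s≤s a≤b , 1+b≤) _ le with b ≤? q
    ... | yes b≤q = ≮⇒≥ λ d<1+b →
      contradiction (≤-trans (multiplicity-pos a≤b ≤-refl) (≤-trans (le b b≤q) (≤-reflexive (absent (s≤s⁻¹ d<1+b))))) λ ()
      where
        absent : d ≤ b → multiplicity (c , d) b ≡ 0
        absent d≤b = cong₂ _+_ (cover-above {c} d≤b) (mirrorCover-vanishes {c} (≤-trans d≤b (≤-trans b≤q (q≤shortTop b≤q))))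
    -- Here t = shortTop b is covered by (a , suc b) together with its mirror image b, which (c , d) misses.
    ... | no b≰q = ≮⇒≥ λ d<1+b →
      contradiction (≤-trans (≤-reflexive (sym twice)) (≤-trans (le t (<⇒≤ t<q)) (at-most-once (s≤s⁻¹ d<1+b)))) λ { (s≤s ()) }
      where
        b≤q+q : b ≤ q + q
        b≤q+q = ≤-trans (s≤s⁻¹ 1+b≤) (m∸n≤m (q + q) a)
        t : ℕ
        t = shortTop b
        mirror-t : shortTop t ≡ b
        mirror-t = shortTop-involutive b≤q+q
        t<q : t < q
        t<q = <-≤-trans (shortTop-strict (≰⇒> b≰q) b≤q+q) (≤-reflexive (m+n∸n≡m q q))
        twice : multiplicity (a , suc b) t ≡ 2
        twice = cong₂ _+_ (cover-inside {b = suc b} (≤-shortTop-swap (≤q⇒≤q+q a≤q) (s≤s⁻¹ 1+b≤)) (<-trans (<-trans t<q (≰⇒> b≰q)) (n<1+n b)))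
                          (mirrorCover-inside {a} t<q (subst (a ≤_) (sym mirror-t) a≤b) (s≤s (≤-reflexive mirror-t)))
        at-most-once : d ≤ b → multiplicity (c , d) t ≤ 1
        at-most-once d≤b = ≤-trans (+-mono-≤ (cover-≤1 c d t) (≤-reflexive (mirrorCover-vanishes {c} (subst (d ≤_) (sym mirror-t) d≤b))))
                                   (≤-reflexive (+-identityʳ 1))

  multiplicity-reflects-⊑ : ∀ {z w} → ValidInterval z → ValidInterval w →
                            (∀ t → t ≤ q → multiplicity z t ≤ multiplicity w t) → z ⊑ w
  multiplicity-reflects-⊑ {a , b} vz vw le = start-reflected vz vw (le a (proj₁ vz)) , end-reflected vz vw le

  ≼⇔⊑ : ∀ {μ γ : Root (suc q)} → μ ≼ γ ⇔ interval μ ⊑ interval γ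
  ≼⇔⊑ {μ} {γ} = mk⇔ ⊑-from-≼ ≼-from-⊑
    where
      ⊑-from-≼ : μ ≼ γ → interval μ ⊑ interval γ
      ⊑-from-≼ (_ , γ≡μ+c) = multiplicity-reflects-⊑ (interval-valid μ) (interval-valid γ) λ t t≤q →
        let k = fromℕ< (s≤s t≤q)
            at-t : ∀ r → coeff r k ≡ multiplicity (interval r) t
            at-t r = trans (coeff-interval r k) (cong (multiplicity (interval r)) (toℕ-fromℕ< (s≤s t≤q)))
        in subst₂ _≤_ (at-t μ) (at-t γ) (subst (coeff μ k ≤_) (sym (γ≡μ+c k)) (m≤m+n _ _))
      ≼-from-⊑ : interval μ ⊑ interval γ → μ ≼ γ
      ≼-from-⊑ μ⊑γ = (λ k → coeff γ k ∸ coeff μ k) , λ k →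
        sym (m+[n∸m]≡n (subst₂ _≤_ (sym (coeff-interval μ k)) (sym (coeff-interval γ k)) (multiplicity-mono μ⊑γ (toℕ k))))

  incomparable⇔staggered : ∀ {μ γ : Root (suc q)} → Incomparable μ γ ⇔ Staggered (interval μ) (interval γ)
  incomparable⇔staggered {μ} {γ} =
    mk⇔ (λ (μ⋠γ , γ⋠μ) → from staggered⇔incomparable (μ⋠γ ∘ from (≼⇔⊑ {μ} {γ}) , γ⋠μ ∘ from (≼⇔⊑ {γ} {μ})))
        (λ st → let (μ⋢γ , γ⋢μ) = to staggered⇔incomparable st in μ⋢γ ∘ to (≼⇔⊑ {μ} {γ}) , γ⋢μ ∘ to (≼⇔⊑ {γ} {μ}))

  private
    short-below-long : ∀ (j j′ : Fin (suc q)) → toℕ j ≢ longEnd j′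
    short-below-long j j′ = <⇒≢ (s≤s (≤-trans (fin≤q j) (q≤shortTop (fin≤q j′))))

    longEnd-injective : ∀ (j j′ : Fin (suc q)) → longEnd j ≡ longEnd j′ → j ≡ j′
    longEnd-injective j j′ eq = toℕ-injective (begin
      toℕ j                         ≡⟨ shortTop-involutive (≤q⇒≤q+q (fin≤q j)) ⟨
      shortTop (shortTop (toℕ j))   ≡⟨ cong (shortTop ∘ ℕ.pred) eq ⟩
      shortTop (shortTop (toℕ j′))  ≡⟨ shortTop-involutive (≤q⇒≤q+q (fin≤q j′)) ⟩
      toℕ j′                        ∎)
      where open ≡-Reasoning

  interval-injective : ∀ {r r′ : Root (suc q)} → interval r ≡ interval r′ → r ≡ r′
  interval-injective {minus i j i<j} {minus i′ j′ i′<j′} eq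
    with toℕ-injective (cong proj₁ eq) | toℕ-injective (cong proj₂ eq)
  ... | refl | refl = cong (minus i j) (<-irrelevant i<j i′<j′)
  interval-injective {minus i j _} {plus i′ j′ _} eq = contradiction (cong proj₂ eq) (short-below-long j j′)
  interval-injective {minus i j _} {long i′} eq = contradiction (cong proj₂ eq) (short-below-long j i′)
  interval-injective {plus i j _} {minus i′ j′ _} eq = contradiction (sym (cong proj₂ eq)) (short-below-long j′ j)
  interval-injective {plus i j i<j} {plus i′ j′ i′<j′} eq
    with toℕ-injective (cong proj₁ eq) | longEnd-injective j j′ (cong proj₂ eq)
  ... | refl | refl = cong (plus i j) (<-irrelevant i<j i′<j′)
  interval-injective {plus i j i<j} {long i′} eq
    with toℕ-injective (cong proj₁ eq) | longEnd-injective j i′ (cong proj₂ eq)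
  ... | refl | refl = contradiction refl (<⇒≢ i<j)
  interval-injective {long i} {minus i′ j′ _} eq = contradiction (sym (cong proj₂ eq)) (short-below-long j′ i)
  interval-injective {long i} {plus i′ j′ i′<j′} eq
    with toℕ-injective (cong proj₁ eq) | longEnd-injective i j′ (cong proj₂ eq)
  ... | refl | refl = contradiction refl (<⇒≢ i′<j′)
  interval-injective {long i} {long i′} eq = cong long (toℕ-injective (cong proj₁ eq))

  shortIntervals-enumerate : Enumerates (map interval shortRoots) (suc q) shortTop
  shortIntervals-enumerate = Unique.map⁺ interval-injective shortRoots-unique , mk⇔ in-staircase from-staircase
    where
      short-in-staircase : ∀ {i j : Fin (suc q)} i<j →
                           InStaircase (suc q) shortTop (interval (minus i j i<j)) × InStaircase (suc q) shortTop (interval (plus i j i<j))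
      short-in-staircase {i} {j} i<j =
        (toℕ<n i , i<j , ≤-trans (fin≤q j) (q≤shortTop (fin≤q i))) ,
        (toℕ<n i , s≤s (≤-trans (fin≤q i) (q≤shortTop (fin≤q j))) , shortTop-strict i<j (≤q⇒≤q+q (fin≤q j)))
      in-staircase : ∀ {z} → z ∈ map interval shortRoots → InStaircase (suc q) shortTop z
      in-staircase z∈ with ∈-map⁻ interval z∈
      ... | r , r∈ , refl = All.lookup (shortRoots-All {P = InStaircase (suc q) shortTop ∘ interval} short-in-staircase) r∈
      from-staircase : ∀ {z} → InStaircase (suc q) shortTop z → z ∈ map interval shortRoots
      from-staircase {x , y} (x<1+q , x<y , y≤) with y ≤? q
      ... | yes y≤q =
        subst (_∈ map interval shortRoots) (cong₂ _,_ (toℕ-fromℕ< x<1+q) (toℕ-fromℕ< (s≤s y≤q)))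
          (∈-map⁺ interval (proj₁ (∈-shortRoots (subst₂ _<_ (sym (toℕ-fromℕ< x<1+q)) (sym (toℕ-fromℕ< (s≤s y≤q))) x<y))))
      ... | no y≰q with ≰⇒> y≰q
      ...   | s≤s {n = c} q≤c =
        subst (_∈ map interval shortRoots) (cong₂ _,_ (toℕ-fromℕ< x<1+q) (cong suc end≡c))
          (∈-map⁺ interval (proj₂ (∈-shortRoots (subst₂ _<_ (sym (toℕ-fromℕ< x<1+q)) (sym (toℕ-fromℕ< (s≤s j≤q))) x<j))))
        where
          c≤q+q : c ≤ q + q
          c≤q+q = ≤-trans (<⇒≤ y≤) (m∸n≤m (q + q) x)
          j≤q : shortTop c ≤ q
          j≤q = ≤-trans (shortTop-mono q≤c) (≤-reflexive (m+n∸n≡m q q))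
          x<j : x < shortTop c
          x<j = <-shortTop-swap (≤-trans (s≤s⁻¹ x<1+q) (m≤m+n q q)) y≤
          end≡c : shortTop (toℕ (fromℕ< (s≤s j≤q))) ≡ c
          end≡c = trans (cong shortTop (toℕ-fromℕ< (s≤s j≤q))) (shortTop-involutive c≤q+q)

  longRoots-comparable : ∀ (i i′ : Fin (suc q)) → ¬ Incomparable (long i) (long i′)
  longRoots-comparable i i′ incomparable with to (incomparable⇔staggered {long i} {long i′}) incomparable
  ... | inj₁ (i<i′ , e<e′) = <⇒≱ e<e′ (s≤s (shortTop-mono (<⇒≤ i<i′)))
  ... | inj₂ (i′<i , e′<e) = <⇒≱ e′<e (s≤s (shortTop-mono (<⇒≤ i′<i)))

  #antichains-interval : ∀ xs k → #antichains (map interval xs) k ≡ Roots.#antichains xs k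
  #antichains-interval = #antichains-map incomparable? staggered? interval (λ {μ} {γ} → incomparable⇔staggered {μ} {γ})

  filter-interval : ∀ μ xs → map interval (filter (incomparable? μ) xs) ≡ filter (staggered? (interval μ)) (map interval xs)
  filter-interval μ xs = trans
    (cong (map interval) (filter-≐ (incomparable? μ) (staggered? (interval μ) ∘ interval)
                                   ((λ {r} → to (incomparable⇔staggered {μ} {r})) , (λ {r} → from (incomparable⇔staggered {μ} {r}))) xs))
    (sym (filter-map (staggered? (interval μ)) interval xs))

  #antichains-shortRoots : ∀ k → Roots.#antichains shortRoots k ≡ #antichains (staircase (suc q) shortTop) k
  #antichains-shortRoots k = trans (sym (#antichains-interval shortRoots k)) (#antichains-enumeration k shortIntervals-enumerate)

  #antichains-belowLongRoot : ∀ i k → Roots.#antichains (filter (incomparable? (long i)) shortRoots) k ≡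
                                      #antichains (belowLong (toℕ i)) k
  #antichains-belowLongRoot i k = begin
    Roots.#antichains (filter (incomparable? (long i)) shortRoots) k
      ≡⟨ #antichains-interval (filter (incomparable? (long i)) shortRoots) k ⟨
    #antichains (map interval (filter (incomparable? (long i)) shortRoots)) k
      ≡⟨ cong (λ xs → #antichains xs k) (filter-interval (long i) shortRoots) ⟩
    #antichains (filter (staggered? (interval (long i))) (map interval shortRoots)) k
      ≡⟨ #antichains-filter-staggered k shortIntervals-enumerate (<⇒≤ (toℕ<n i))
           (λ x<i → shortTop-mono (<⇒≤ x<i)) (λ i<x _ → shortTop-mono (<⇒≤ i<x)) ⟩
    #antichains (belowLong (toℕ i)) k ∎
    where open ≡-Reasoning

  numAntichains-noLong-binomial : ∀ k → numAntichains (suc q) k 0 ≡ (suc q C k) * (q C k)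
  numAntichains-noLong-binomial k =
    trans (numAntichains-noLong {suc q} k) (trans (#antichains-shortRoots k) (#antichains-shortStaircase k))

  numAntichains-oneLong-binomial : ∀ k → numAntichains (suc q) k 1 ≡ (suc q C suc k) * (q C k)
  numAntichains-oneLong-binomial k = begin
    numAntichains (suc q) k 1
      ≡⟨ numAntichains-oneLong longRoots-comparable k ⟩
    sum (map (λ i → Roots.#antichains (filter (incomparable? (long i)) shortRoots) k) (allFin (suc q)))
      ≡⟨ cong sum (map-cong (λ i → #antichains-belowLongRoot i k) (allFin (suc q))) ⟩
    sum (map (below ∘ toℕ) (allFin (suc q)))
      ≡⟨ cong sum (trans (map-tabulate {n = suc q} id (below ∘ toℕ)) (tabulate-toℕ (suc q) below)) ⟩
    sum (applyUpTo below (suc q))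
      ≡⟨ sum-#antichains-belowLong k ⟩
    (suc q C suc k) * (q C k) ∎
    where
      open ≡-Reasoning
      below : ℕ → ℕ
      below x = #antichains (belowLong x) k

mainTheorem18 : (p : ℕ) → 2 ≤ p → (k : ℕ) → k < p →
    (numAntichains p k 0 ≡ (p C k) * ((p ∸ 1) C k))
    × (numAntichains p k 0 ≡ numAntichains p (p ∸ 1 ∸ k) 1)
mainTheorem18 (suc q) _ k k<p = noLong , trans noLong (sym oneLong)
  where
    open RootsAsIntervals q
    k≤q : k ≤ q
    k≤q = s≤s⁻¹ k<p
    noLong : numAntichains (suc q) k 0 ≡ (suc q C k) * (q C k)
    noLong = numAntichains-noLong-binomial k
    oneLong : numAntichains (suc q) (q ∸ k) 1 ≡ (suc q C k) * (q C k)
    oneLong = trans (numAntichains-oneLong-binomial (q ∸ k))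
      (cong₂ _*_ (trans (cong (suc q C_) (sym (+-∸-assoc 1 k≤q))) (sym (nCk≡nC[n∸k] (m≤n⇒m≤1+n k≤q))))
                 (sym (nCk≡nC[n∸k] k≤q)))
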